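{- Let $m,n\ge 1$ be integers and $0\le p\le m-1$, and let $G$ be one of $TnC_m(n)$, $TG^{(p)}_m(n)$, $KB^{(p)}_m(n)$. Then the code matrix $[\alpha_{i,j}]_{m\times n}$ of every 2-factor of $G$ satisfies the following conditions (with $\alpha_{m+1,j}:=\alpha_{1,j}$ and row indices read modulo $m$ in $\{1,\dots,m\}$): 1. (Column condition) for every $1\le j\le n$ and every $1\le i\le m$, $(\alpha_{i,j},\alpha_{i+1,j})$ is an arc of ${\cal D}_{ud}$; 2. (Adjacency of columns) for every $1\le j\le n-1$ and every $1\le i\le m$, $(\alpha_{i,j},\alpha_{i,j+1})$ is an arc of ${\cal D}_{lr}$; 3. (First and last column) (a) if $G=TnC_m(n)$: every entry of the first column lies in $\{a,b,c\}$ and every entry of the last column lies in $\{b,d,f\}$; (b) if $G=TG^{(p)}_m(n)$: $(\alpha_{i+p,n},\alpha_{i,1})$ is an arc of ${\cal D}_{lr}$ for all $1\le i\le m$; (c) if $G=KB^{(p)}_m(n)$: $(\alpha_{m+p+1-i,n},\overline{\alpha_{i,1}})$ is an arc of ${\cal D}_{lr}$ for all $1\le i\le m$. Conversely, for every $m\times n$ matrix with entries in $\{a,b,c,d,e,f\}$ satisfying conditions 1–3 (for the corresponding $G$) there is a unique 2-factor of $G$ whose code matrix is this matrix.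
   Context: Directions and letters: the six alpha-letters denote the 2-element subsets of $\{\text{up},\text{down},\text{left},\text{right}\}$: $a=\{\text{right},\text{down}\}$, $b=\{\text{up},\text{down}\}$, $c=\{\text{right},\text{up}\}$, $d=\{\text{left},\text{down}\}$, $e=\{\text{left},\text{right}\}$, $f=\{\text{left},\text{up}\}$. For a letter $\alpha$, $\overline{\alpha}$ is the letter obtained by exchanging up and down ($a\leftrightarrow c$, $d\leftrightarrow f$, $b,e$ fixed). ${\cal D}_{ud}$ is the digraph (loops allowed) on $\{a,\dots,f\}$ with an arc $(\alpha,\beta)$ iff ($\text{down}\in\alpha \iff \text{up}\in\beta$); ${\cal D}_{lr}$ is the digraph on $\{a,\dots,f\}$ with an arc $(\alpha,\beta)$ iff ($\text{right}\in\alpha\iff\text{left}\in\beta$). Graphs: row indices are taken modulo $m$ in $\{1,\dots,m\}$. All graphs below are multigraphs (loops and parallel edges allowed; for $m,n\ge 3$ they are the usual simple grid graphs) on vertex set $\{1,\dots,m\}\times\{1,\dots,n\}$ (vertex $(i,j)$ = row $i$ counted from the top, column $j$ counted from the left), where each edge-end carries a direction. Common edges: for every $j$ and every $1\le i\le m$, a vertical edge joining $(i,j)$ (its end there has direction down) to $(i+1,j)$ (end direction up); for every $i$ and $1\le j\le n-1$, a horizontal edge joining $(i,j)$ (direction right) to $(i,j+1)$ (direction left). The thin grid cylinder $TnC_m(n)=C_m\times P_n$ has exactly these edges. The torus grid $TG^{(p)}_m(n)$ has in addition, for each $1\le i\le m$, an edge joining $(i+p,n)$ (direction right) to $(i,1)$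 (direction left). The Klein bottle grid $KB^{(p)}_m(n)$ has in addition, for each $1\le i\le m$, an edge joining $(m+p+1-i,n)$ (direction right) to $(i,1)$ (direction left). A 2-factor is a set $S$ of edges such that every vertex carries exactly two edge-ends of edges of $S$ (a loop contributes both of its ends). The code matrix of a 2-factor $S$ is the $m\times n$ matrix $[\alpha_{i,j}]$ where $\alpha_{i,j}$ is the alpha-letter equal to the set of directions of the two edge-ends of $S$ at $(i,j)$. -}

module Defs where

open import Data.Nat using (ℕ; zero; suc; _+_)
open import Data.Nat.DivMod using (_mod_)
open import Data.Fin using (Fin; zero; suc; toℕ; inject₁; fromℕ; opposite; _≟_)
open import Data.Bool using (Bool; true; false; _∧_; if_then_else_; T)
open import Data.List using (List; []; _∷_; _++_; map; concatMap; allFin)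
open import Data.Nat.ListAction using (sum)
open import Data.Product using (_×_; _,_; proj₁; proj₂; Σ; ∃-syntax)
open import Data.Sum using (_⊎_)
open import Relation.Nullary.Decidable using (isYes)
open import Relation.Binary.PropositionalEquality using (_≡_)
open import Function.Bundles using (_⇔_)

data Dir : Set where
  up down left right : Dir

data Letter : Set where
  a b c d e f : Letter

dirs : Letter → Dir → Bool
dirs a right = true
dirs a down  = true
dirs b up    = true
dirs b down  = true
dirs c right = true
dirs c up    = true
dirs d left  = true
dirs d down  = true
dirs e left  = true
dirs e right = true
dirs f left  = true
dirs f up    = true
dirs _ _     = false

_∈ᴸ_ : Dir → Letter → Set
δ ∈ᴸ α = T (dirs α δ)

-- exchange up and down
bar : Letter → Letter
bar a = c
bar b = b
bar c = a
bar d = f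
bar e = e
bar f = d

Dud : Letter → Letter → Set
Dud α β = (down ∈ᴸ α) ⇔ (up ∈ᴸ β)

Dlr : Letter → Letter → Set
Dlr α β = (right ∈ᴸ α) ⇔ (left ∈ᴸ β)

-- Throughout, m = suc m' rows and n = suc n' columns (so m, n ≥ 1
-- range over all positive integers).  Rows/columns are indexed 0-based by
-- Fin: paper row i (1..m) is Fin index i-1, similarly for columns.

_⊕_ : {m' : ℕ} → Fin (suc m') → ℕ → Fin (suc m')
_⊕_ {m'} i k = (toℕ i + k) mod (suc m')

-- paper's row m+p+1-i (mod m) for paper row i, in 0-based indexing:
-- 0-based i ↦ (m - 1 - i) + p  mod m
kbRow : {m' : ℕ} → Fin (suc m') → Fin (suc m') → Fin (suc m')
kbRow {m'} p i = (toℕ (opposite i) + toℕ p) mod (suc m')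

data Kind (m' : ℕ) : Set where
  TnC : Kind m'                   -- thin grid cylinder  C_m × P_n
  TG  : Fin (suc m') → Kind m'
  KB  : Fin (suc m') → Kind m'

Vertex : ℕ → ℕ → Set
Vertex m' n' = Fin (suc m') × Fin (suc n')

End : ℕ → ℕ → Set
End m' n' = Vertex m' n' × Dir

data Edge (m' n' : ℕ) : Kind m' → Set where
  ver  : ∀ {k} → Fin (suc m') → Fin (suc n') → Edge m' n' k
  hor  : ∀ {k} → Fin (suc m') → Fin n' → Edge m' n' k
  wTG  : ∀ {p} → Fin (suc m') → Edge m' n' (TG p)
  wKB  : ∀ {p} → Fin (suc m') → Edge m' n' (KB p)

ends : ∀ {m' n'} {k : Kind m'} → Edge m' n' k → End m' n' × End m' n'
ends (ver i j) = ((i , j) , down) , ((i ⊕ 1 , j) , up)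
ends (hor i j) = ((i , inject₁ j) , right) , ((i , suc j) , left)
ends {n' = n'} (wTG {p} i) = ((i ⊕ toℕ p , fromℕ n') , right) , ((i , zero) , left)
ends {n' = n'} (wKB {p} i) = ((kbRow p i , fromℕ n') , right) , ((i , zero) , left)

-- explicit enumeration of all edges (each exactly once)
edgeList : ∀ m' n' (k : Kind m') → List (Edge m' n' k)
edgeList m' n' k =
     concatMap (λ i → map (ver i) (allFin (suc n'))) (allFin (suc m'))
  ++ concatMap (λ i → map (hor i) (allFin n')) (allFin (suc m'))
  ++ extra k
  where
  extra : (k : Kind m') → List (Edge m' n' k)
  extra TnC    = []
  extra (TG p) = map wTG (allFin (suc m'))
  extra (KB p) = map wKB (allFin (suc m'))

EdgeSet : ∀ m' n' → Kind m' → Set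
EdgeSet m' n' k = Edge m' n' k → Bool

sameVertex : ∀ {m' n'} → Vertex m' n' → Vertex m' n' → Bool
sameVertex (i , j) (i' , j') = isYes (i ≟ i') ∧ isYes (j ≟ j')

b2n : Bool → ℕ
b2n true  = 1
b2n false = 0

-- number of edge-ends of the edge e at vertex v (a loop counts twice)
endsAt : ∀ {m' n'} {k : Kind m'} → Vertex m' n' → Edge m' n' k → ℕ
endsAt v ed = b2n (sameVertex v (proj₁ (proj₁ (ends ed))))
           + b2n (sameVertex v (proj₁ (proj₂ (ends ed))))

degree : ∀ {m' n'} {k : Kind m'} → EdgeSet m' n' k → Vertex m' n' → ℕ
degree {m'} {n'} {k} S v =
  sum (map (λ ed → if S ed then endsAt v ed else 0) (edgeList m' n' k))

TwoFactor : ∀ {m' n'} {k : Kind m'} → EdgeSet m' n' k → Set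
TwoFactor S = ∀ v → degree S v ≡ 2

Matrix : ℕ → ℕ → Set
Matrix m' n' = Fin (suc m') → Fin (suc n') → Letter

IsCodeMatrix : ∀ {m' n'} {k : Kind m'} → EdgeSet m' n' k → Matrix m' n' → Set
IsCodeMatrix {m'} {n'} {k} S M =
  ∀ i j (δ : Dir) →
    (δ ∈ᴸ M i j) ⇔
    (∃[ ed ] (S ed ≡ true ×
       (proj₁ (ends ed) ≡ ((i , j) , δ) ⊎ proj₂ (ends ed) ≡ ((i , j) , δ))))

ColumnCond : ∀ {m' n'} → Matrix m' n' → Set
ColumnCond M = ∀ i j → Dud (M i j) (M (i ⊕ 1) j)

AdjCond : ∀ {m' n'} → Matrix m' n' → Set
AdjCond {m'} {n'} M = ∀ i (j : Fin n') → Dlr (M i (inject₁ j)) (M i (suc j))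

InABC : Letter → Set
InABC α = (α ≡ a) ⊎ (α ≡ b) ⊎ (α ≡ c)

InBDF : Letter → Set
InBDF α = (α ≡ b) ⊎ (α ≡ d) ⊎ (α ≡ f)

BoundaryCond : ∀ {m' n'} → Kind m' → Matrix m' n' → Set
BoundaryCond {m'} {n'} TnC M =
  (∀ i → InABC (M i zero)) × (∀ i → InBDF (M i (fromℕ n')))
BoundaryCond {m'} {n'} (TG p) M =
  ∀ i → Dlr (M (i ⊕ toℕ p) (fromℕ n')) (M i zero)
BoundaryCond {m'} {n'} (KB p) M =
  ∀ i → Dlr (M (kbRow p i) (fromℕ n')) (bar (M i zero))

Conditions : ∀ {m' n'} → Kind m' → Matrix m' n' → Set
Conditions k M = ColumnCond M × AdjCond M × BoundaryCond k M

-- Every edge-end (a vertex with a direction) belongs to at most one edge, and edgeAt recovers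
-- that edge from the end; the only ends belonging to no edge are the left ends of the first
-- and the right ends of the last column of the thin cylinder.  Hence the degree of a vertex in
-- an edge set S is the number of directions whose end is occupied by an edge of S, so S is a
-- 2-factor iff the occupied directions at every vertex form an alpha-letter.  Conditions 1–3
-- say exactly that every edge has both or neither of its ends selected by the matrix and that
-- no free end is selected; under them the matrix is the code matrix of the set of edges whose
-- first end it selects, and of no other edge set.
module Submission where

open import Defs
open import Data.Nat using (ℕ; zero; suc; _+_; _*_; _%_)
open import Data.Nat.Properties using (+-assoc; +-comm; *-suc; +-identityʳ)
open import Data.Nat.DivMod using (%-distribˡ-+; m%n%n≡m%n; [m+kn]%n≡m%n; m<n⇒m%n≡m)
open import Data.Nat.ListAction using (sum)
open import Data.Nat.Tactic.RingSolver using (solve-∀)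
open import Data.Fin using (Fin; zero; suc; toℕ; fromℕ; opposite; _≟_)
open import Data.Fin.Properties using (toℕ-fromℕ<; toℕ-injective; toℕ<n; opposite-involutive)
open import Data.Fin.Relation.Unary.Top using (view; ‵fromℕ; ‵inj₁; view-fromℕ; view-inject₁)
open import Data.Bool using (Bool; true; false; T; _∧_; if_then_else_)
open import Data.Bool.Properties using (T-∧; T-≡; ⇔→≡)
open import Data.Maybe using (Maybe; just; nothing; maybe′)
open import Data.Maybe.Properties using (just-injective)
open import Data.List using (List; []; _∷_; _++_; map; concatMap; allFin; cartesianProductWith)
open import Data.List.Properties using (map-cong)
open import Data.List.Membership.Propositional using (_∈_)
open import Data.List.Membership.Propositional.Properties
  using (∈-map⁺; ∈-++⁺ˡ; ∈-++⁺ʳ; ∈-allFin; ∈-cartesianProductWith⁺)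
open import Data.List.Relation.Unary.All as All using (All; []; _∷_)
import Data.List.Relation.Unary.All.Properties as Allₚ
open import Data.List.Relation.Unary.Any using (here; there)
open import Data.List.Relation.Unary.AllPairs using ([]; _∷_)
open import Data.List.Relation.Unary.Unique.Propositional using (Unique)
import Data.List.Relation.Unary.Unique.Propositional.Properties as Uniqueₚ
open import Data.List.Relation.Binary.Disjoint.Propositional using (Disjoint)
open import Data.Product using (_×_; _,_; proj₁; proj₂; Σ; ∃-syntax)
open import Data.Product.Properties using (×-≡,≡→≡; ×-≡,≡←≡)
open import Data.Sum using (_⊎_; inj₁; inj₂)
open import Data.Empty using (⊥-elim)
open import Data.Unit using (tt)
open import Function.Bundles using (_⇔_; mk⇔; Equivalence)
open import Function.Properties.Equivalence using () renaming (sym to ⇔-sym; trans to ⇔-trans)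
open import Relation.Binary.Definitions using (DecidableEquality)
open import Relation.Binary.PropositionalEquality
  using (_≡_; _≢_; refl; sym; trans; cong; cong₂; subst; ≢-sym; setoid; module ≡-Reasoning)
open import Relation.Nullary using (¬_; Dec; yes; no)
open import Relation.Nullary.Decidable using (isYes; toWitness; fromWitness)

open Equivalence

module _ {m' : ℕ} where

  toℕ-⊕ : ∀ (i : Fin (suc m')) k → toℕ (i ⊕ k) ≡ (toℕ i + k) % suc m'
  toℕ-⊕ i k = toℕ-fromℕ< _

  ⊕-⊕ : ∀ (i : Fin (suc m')) k l → (i ⊕ k) ⊕ l ≡ i ⊕ (k + l)
  ⊕-⊕ i k l = toℕ-injective (begin
    toℕ ((i ⊕ k) ⊕ l)                  ≡⟨ toℕ-⊕ (i ⊕ k) l ⟩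
    (toℕ (i ⊕ k) + l) % m              ≡⟨ cong (λ t → (t + l) % m) (toℕ-⊕ i k) ⟩
    ((toℕ i + k) % m + l) % m          ≡⟨ %-distribˡ-+ ((toℕ i + k) % m) l m ⟩
    ((toℕ i + k) % m % m + l % m) % m  ≡⟨ cong (λ t → (t + l % m) % m) (m%n%n≡m%n (toℕ i + k) m) ⟩
    ((toℕ i + k) % m + l % m) % m      ≡⟨ %-distribˡ-+ (toℕ i + k) l m ⟨
    (toℕ i + k + l) % m                ≡⟨ cong (_% m) (+-assoc (toℕ i) k l) ⟩
    (toℕ i + (k + l)) % m              ≡⟨ toℕ-⊕ i (k + l) ⟨
    toℕ (i ⊕ (k + l))                  ∎)
    where
    open ≡-Reasoning
    m = suc m'

  ⊕-multiple : ∀ (i : Fin (suc m')) q → i ⊕ (q * suc m') ≡ i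
  ⊕-multiple i q = toℕ-injective (begin
    toℕ (i ⊕ (q * suc m'))         ≡⟨ toℕ-⊕ i (q * suc m') ⟩
    (toℕ i + q * suc m') % suc m'  ≡⟨ [m+kn]%n≡m%n (toℕ i) q (suc m') ⟩
    toℕ i % suc m'                 ≡⟨ m<n⇒m%n≡m (toℕ<n i) ⟩
    toℕ i                          ∎)
    where open ≡-Reasoning

  -- k * m' ≡ -k modulo m' + 1.
  _⊖_ : Fin (suc m') → ℕ → Fin (suc m')
  i ⊖ k = i ⊕ (k * m')

  ⊖-⊕ : ∀ (i : Fin (suc m')) k → (i ⊖ k) ⊕ k ≡ i
  ⊖-⊕ i k = begin
    (i ⊕ (k * m')) ⊕ k  ≡⟨ ⊕-⊕ i (k * m') k ⟩
    i ⊕ (k * m' + k)    ≡⟨ cong (i ⊕_) (trans (+-comm (k * m') k) (sym (*-suc k m'))) ⟩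
    i ⊕ (k * suc m')    ≡⟨ ⊕-multiple i k ⟩
    i                   ∎
    where open ≡-Reasoning

  ⊕-⊖ : ∀ (i : Fin (suc m')) k → (i ⊕ k) ⊖ k ≡ i
  ⊕-⊖ i k = begin
    (i ⊕ k) ⊕ (k * m')  ≡⟨ ⊕-⊕ i k (k * m') ⟩
    i ⊕ (k + k * m')    ≡⟨ cong (i ⊕_) (sym (*-suc k m')) ⟩
    i ⊕ (k * suc m')    ≡⟨ ⊕-multiple i k ⟩
    i                   ∎
    where open ≡-Reasoning

_≟ᴰ_ : DecidableEquality Dir
up    ≟ᴰ up    = yes refl
down  ≟ᴰ down  = yes refl
left  ≟ᴰ left  = yes refl
right ≟ᴰ right = yes refl
up    ≟ᴰ down  = no λ ()
up    ≟ᴰ left  = no λ ()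
up    ≟ᴰ right = no λ ()
down  ≟ᴰ up    = no λ ()
down  ≟ᴰ left  = no λ ()
down  ≟ᴰ right = no λ ()
left  ≟ᴰ up    = no λ ()
left  ≟ᴰ down  = no λ ()
left  ≟ᴰ right = no λ ()
right ≟ᴰ up    = no λ ()
right ≟ᴰ down  = no λ ()
right ≟ᴰ left  = no λ ()

Σᴰ : (Dir → ℕ) → ℕ
Σᴰ g = g up + g down + g left + g right

+-shuffle : ∀ p₁ p₂ p₃ p₄ q₁ q₂ q₃ q₄ →
  (p₁ + p₂ + p₃ + p₄) + (q₁ + q₂ + q₃ + q₄) ≡ (p₁ + q₁) + (p₂ + q₂) + (p₃ + q₃) + (p₄ + q₄)
+-shuffle = solve-∀

Σᴰ-+ : (g h : Dir → ℕ) → Σᴰ g + Σᴰ h ≡ Σᴰ (λ δ → g δ + h δ)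
Σᴰ-+ g h = +-shuffle (g up) (g down) (g left) (g right) (h up) (h down) (h left) (h right)

Σᴰ-cong : {g h : Dir → ℕ} → (∀ δ → g δ ≡ h δ) → Σᴰ g ≡ Σᴰ h
Σᴰ-cong eq = cong₂ _+_ (cong₂ _+_ (cong₂ _+_ (eq up) (eq down)) (eq left)) (eq right)

indicator-split : ∀ s δ₀ → b2n s ≡ Σᴰ (λ δ → b2n (s ∧ isYes (δ ≟ᴰ δ₀)))
indicator-split false _     = refl
indicator-split true  up    = refl
indicator-split true  down  = refl
indicator-split true  left  = refl
indicator-split true  right = refl

dirs-Σᴰ : ∀ α → Σᴰ (λ δ → b2n (dirs α δ)) ≡ 2
dirs-Σᴰ a = refl
dirs-Σᴰ b = refl
dirs-Σᴰ c = refl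
dirs-Σᴰ d = refl
dirs-Σᴰ e = refl
dirs-Σᴰ f = refl

letter-with-dirs : (g : Dir → Bool) → Σᴰ (λ δ → b2n (g δ)) ≡ 2 → ∃[ α ] (∀ δ → dirs α δ ≡ g δ)
letter-with-dirs g two with g up in u | g down in dn | g left in l | g right in r
... | true  | true  | false | false = b , λ { up → sym u ; down → sym dn ; left → sym l ; right → sym r }
... | true  | false | true  | false = f , λ { up → sym u ; down → sym dn ; left → sym l ; right → sym r }
... | true  | false | false | true  = c , λ { up → sym u ; down → sym dn ; left → sym l ; right → sym r }
... | false | true  | true  | false = d , λ { up → sym u ; down → sym dn ; left → sym l ; right → sym r }
... | false | true  | false | true  = a , λ { up → sym u ; down → sym dn ; left → sym l ; right → sym r }
... | false | false | true  | true  = e , λ { up → sym u ; down → sym dn ; left → sym l ; right → sym r }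
letter-with-dirs g () | true  | true  | true  | _
letter-with-dirs g () | true  | true  | false | true
letter-with-dirs g () | true  | false | true  | true
letter-with-dirs g () | false | true  | true  | true
letter-with-dirs g () | true  | false | false | false
letter-with-dirs g () | false | true  | false | false
letter-with-dirs g () | false | false | true  | false
letter-with-dirs g () | false | false | false | true
letter-with-dirs g () | false | false | false | false

bar-left : ∀ α → dirs (bar α) left ≡ dirs α left
bar-left a = refl
bar-left b = refl
bar-left c = refl
bar-left d = refl
bar-left e = refl
bar-left f = refl

InABC⇔left∉ : ∀ α → InABC α ⇔ dirs α left ≡ false
InABC⇔left∉ a = mk⇔ (λ _ → refl) (λ _ → inj₁ refl)
InABC⇔left∉ b = mk⇔ (λ _ → refl) (λ _ → inj₂ (inj₁ refl))
InABC⇔left∉ c = mk⇔ (λ _ → refl) (λ _ → inj₂ (inj₂ refl))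
InABC⇔left∉ d = mk⇔ (λ { (inj₁ ()) ; (inj₂ (inj₁ ())) ; (inj₂ (inj₂ ())) }) (λ ())
InABC⇔left∉ e = mk⇔ (λ { (inj₁ ()) ; (inj₂ (inj₁ ())) ; (inj₂ (inj₂ ())) }) (λ ())
InABC⇔left∉ f = mk⇔ (λ { (inj₁ ()) ; (inj₂ (inj₁ ())) ; (inj₂ (inj₂ ())) }) (λ ())

InBDF⇔right∉ : ∀ α → InBDF α ⇔ dirs α right ≡ false
InBDF⇔right∉ a = mk⇔ (λ { (inj₁ ()) ; (inj₂ (inj₁ ())) ; (inj₂ (inj₂ ())) }) (λ ())
InBDF⇔right∉ b = mk⇔ (λ _ → refl) (λ _ → inj₁ refl)
InBDF⇔right∉ c = mk⇔ (λ { (inj₁ ()) ; (inj₂ (inj₁ ())) ; (inj₂ (inj₂ ())) }) (λ ())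
InBDF⇔right∉ d = mk⇔ (λ _ → refl) (λ _ → inj₂ (inj₁ refl))
InBDF⇔right∉ e = mk⇔ (λ { (inj₁ ()) ; (inj₂ (inj₁ ())) ; (inj₂ (inj₂ ())) }) (λ ())
InBDF⇔right∉ f = mk⇔ (λ _ → refl) (λ _ → inj₂ (inj₂ refl))

T-⇔⇒≡ : ∀ {x y} → T x ⇔ T y → x ≡ y
T-⇔⇒≡ x⇔y = ⇔→≡ (⇔-trans (⇔-sym T-≡) (⇔-trans x⇔y T-≡))

≡⇒T-⇔ : ∀ {x y} → x ≡ y → T x ⇔ T y
≡⇒T-⇔ refl = mk⇔ (λ t → t) (λ t → t)

¬T⇒≡false : ∀ {x} → ¬ T x → x ≡ false
¬T⇒≡false {false} _   = refl
¬T⇒≡false {true}  ¬tt = ⊥-elim (¬tt tt)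

T-isYes : ∀ {P : Set} (P? : Dec P) → T (isYes P?) ⇔ P
T-isYes P? = mk⇔ toWitness fromWitness

T-∧-pair : ∀ {A B : Set} {x y : Bool} {p p' : A} {q q' : B} →
  T x ⇔ p ≡ p' → T y ⇔ q ≡ q' → T (x ∧ y) ⇔ (p , q) ≡ (p' , q')
T-∧-pair x⇔ y⇔ = mk⇔
  (λ t → let (tx , ty) = to T-∧ t in ×-≡,≡→≡ (to x⇔ tx , to y⇔ ty))
  (λ eq → let (eq₁ , eq₂) = ×-≡,≡←≡ eq in from T-∧ (from x⇔ eq₁ , from y⇔ eq₂))

module _ {A : Set} where

  sum-map-zero : (φ : A → ℕ) {xs : List A} → All (λ x → φ x ≡ 0) xs → sum (map φ xs) ≡ 0
  sum-map-zero φ []           = refl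
  sum-map-zero φ (φx≡0 ∷ all) = cong₂ _+_ φx≡0 (sum-map-zero φ all)

  sum-map-single : (φ : A → ℕ) {x : A} {xs : List A} → Unique xs → x ∈ xs →
    (∀ y → y ≢ x → φ y ≡ 0) → sum (map φ xs) ≡ φ x
  sum-map-single φ (y∉ys ∷ _) (here refl) away =
    trans (cong (φ _ +_) (sum-map-zero φ (All.map (λ x≢y → away _ (≢-sym x≢y)) y∉ys))) (+-identityʳ _)
  sum-map-single φ {xs = y ∷ _} (y∉ys ∷ u) (there x∈ys) away =
    cong₂ _+_ (away y (All.lookup y∉ys x∈ys)) (sum-map-single φ u x∈ys away)

  sum-map-Σᴰ : (F : Dir → A → ℕ) (xs : List A) →
    sum (map (λ x → Σᴰ (λ δ → F δ x)) xs) ≡ Σᴰ (λ δ → sum (map (F δ) xs))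
  sum-map-Σᴰ F []       = refl
  sum-map-Σᴰ F (x ∷ xs) = trans (cong (Σᴰ (λ δ → F δ x) +_) (sum-map-Σᴰ F xs))
                                (Σᴰ-+ (λ δ → F δ x) (λ δ → sum (map (F δ) xs)))

  disjoint-by : ∀ {B : Set} (g : A → B) {y₀ xs ys} →
    All (λ x → g x ≡ y₀) xs → All (λ y → g y ≢ y₀) ys → Disjoint xs ys
  disjoint-by g p q (x∈xs , x∈ys) = All.lookup q x∈ys (All.lookup p x∈xs)

module _ {A B C : Set} (g : A → B → C) where

  concatMap-map : ∀ xs ys → concatMap (λ x → map (g x) ys) xs ≡ cartesianProductWith g xs ys
  concatMap-map []       ys = refl
  concatMap-map (x ∷ xs) ys = cong (map (g x) ys ++_) (concatMap-map xs ys)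

  unique-concatMap-map : (∀ {w x y z} → g w y ≡ g x z → w ≡ x × y ≡ z) → ∀ {xs ys} →
    Unique xs → Unique ys → Unique (concatMap (λ x → map (g x) ys) xs)
  unique-concatMap-map g-inj {xs} {ys} uxs uys =
    subst Unique (sym (concatMap-map xs ys)) (Uniqueₚ.cartesianProductWith⁺ g g-inj uxs uys)

  all-concatMap-map : ∀ {P : C → Set} xs ys → (∀ x y → P (g x y)) →
    All P (concatMap (λ x → map (g x) ys) xs)
  all-concatMap-map xs ys Pg = subst (All _) (sym (concatMap-map xs ys))
    (Allₚ.cartesianProductWith⁺ (setoid _) (setoid _) g xs ys λ {x} {y} _ _ → Pg x y)

  ∈-concatMap-map : ∀ {x y xs ys} → x ∈ xs → y ∈ ys → g x y ∈ concatMap (λ x → map (g x) ys) xs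
  ∈-concatMap-map {xs = xs} {ys} x∈ y∈ =
    subst (_ ∈_) (sym (concatMap-map xs ys)) (∈-cartesianProductWith⁺ g x∈ y∈)

data Sort : Set where
  vertical horizontal wrapping : Sort

module _ {m' n' : ℕ} where

  private
    variable
      k : Kind m'

  HasEnd : Edge m' n' k → End m' n' → Set
  HasEnd ed x = proj₁ (ends ed) ≡ x ⊎ proj₂ (ends ed) ≡ x

  -- Even a loop (m = 1) has two distinct ends: they differ in direction.
  ends-distinct : (ed : Edge m' n' k) → proj₁ (ends ed) ≢ proj₂ (ends ed)
  ends-distinct (ver i j) ()
  ends-distinct (hor i j) ()
  ends-distinct (wTG i)   ()
  ends-distinct (wKB i)   ()

  rightWrap : (k : Kind m') → Fin (suc m') → Maybe (Edge m' n' k)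
  rightWrap TnC    i = nothing
  rightWrap (TG p) i = just (wTG (i ⊖ toℕ p))
  rightWrap (KB p) i = just (wKB (opposite (i ⊖ toℕ p)))

  leftWrap : (k : Kind m') → Fin (suc m') → Maybe (Edge m' n' k)
  leftWrap TnC    i = nothing
  leftWrap (TG p) i = just (wTG i)
  leftWrap (KB p) i = just (wKB i)

  edgeAt : (k : Kind m') → End m' n' → Maybe (Edge m' n' k)
  edgeAt k ((i , j) , down)       = just (ver i j)
  edgeAt k ((i , j) , up)         = just (ver (i ⊖ 1) j)
  edgeAt k ((i , j) , right) with view j
  ... | ‵fromℕ                   = rightWrap k i
  ... | ‵inj₁ {i = j'} _         = just (hor i j')
  edgeAt k ((i , zero) , left)    = leftWrap k i
  edgeAt k ((i , suc j) , left)   = just (hor i j)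

  edgeAt-rightmost : (k : Kind m') (i : Fin (suc m')) → edgeAt k ((i , fromℕ n') , right) ≡ rightWrap k i
  edgeAt-rightmost k i rewrite view-fromℕ n' = refl

  edgeAt-end₁ : (ed : Edge m' n' k) → edgeAt k (proj₁ (ends ed)) ≡ just ed
  edgeAt-end₁ (ver i j)   = refl
  edgeAt-end₁ (hor i j)   rewrite view-inject₁ j = refl
  edgeAt-end₁ (wTG {p} i) = trans (edgeAt-rightmost (TG p) (i ⊕ toℕ p))
    (cong (λ r → just (wTG r)) (⊕-⊖ i (toℕ p)))
  edgeAt-end₁ (wKB {p} i) = trans (edgeAt-rightmost (KB p) (kbRow p i))
    (cong (λ r → just (wKB r)) (trans (cong opposite (⊕-⊖ (opposite i) (toℕ p))) (opposite-involutive i)))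

  edgeAt-end₂ : (ed : Edge m' n' k) → edgeAt k (proj₂ (ends ed)) ≡ just ed
  edgeAt-end₂ (ver i j) = cong (λ r → just (ver r j)) (⊕-⊖ i 1)
  edgeAt-end₂ (hor i j) = refl
  edgeAt-end₂ (wTG i)   = refl
  edgeAt-end₂ (wKB i)   = refl

  edgeAt-hasEnd : (ed : Edge m' n' k) {x : End m' n'} → HasEnd ed x → edgeAt k x ≡ just ed
  edgeAt-hasEnd ed (inj₁ refl) = edgeAt-end₁ ed
  edgeAt-hasEnd ed (inj₂ refl) = edgeAt-end₂ ed

  rightWrap-hasEnd : ∀ i {ed : Edge m' n' k} → rightWrap k i ≡ just ed →
    HasEnd ed ((i , fromℕ n') , right)
  rightWrap-hasEnd {TG p} i refl = inj₁ (cong (λ r → ((r , fromℕ n') , right)) (⊖-⊕ i (toℕ p)))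
  rightWrap-hasEnd {KB p} i refl = inj₁ (cong (λ r → ((r , fromℕ n') , right))
    (trans (cong (_⊕ toℕ p) (opposite-involutive (i ⊖ toℕ p))) (⊖-⊕ i (toℕ p))))

  leftWrap-hasEnd : ∀ i {ed : Edge m' n' k} → leftWrap k i ≡ just ed → HasEnd ed ((i , zero) , left)
  leftWrap-hasEnd {TG p} i refl = inj₂ refl
  leftWrap-hasEnd {KB p} i refl = inj₂ refl

  edgeAt-sound : ∀ (x : End m' n') {ed : Edge m' n' k} → edgeAt k x ≡ just ed → HasEnd ed x
  edgeAt-sound ((i , j) , down)     refl = inj₁ refl
  edgeAt-sound ((i , j) , up)       refl = inj₂ (cong (λ r → ((r , j) , up)) (⊖-⊕ i 1))
  edgeAt-sound ((i , j) , right)    eq with view j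
  ... | ‵fromℕ = rightWrap-hasEnd i eq
  edgeAt-sound ((i , _) , right)    refl | ‵inj₁ _ = inj₁ refl
  edgeAt-sound ((i , zero) , left)  eq   = leftWrap-hasEnd i eq
  edgeAt-sound ((i , suc j) , left) refl = inj₂ refl

  hasEnd-unique : ∀ {x : End m' n'} {ed₀ : Edge m' n' k} (ed : Edge m' n' k) →
    edgeAt k x ≡ just ed₀ → HasEnd ed x → ed ≡ ed₀
  hasEnd-unique ed eq h = just-injective (trans (sym (edgeAt-hasEnd ed h)) eq)

  edgeAt-nothing⇒¬hasEnd : ∀ {x : End m' n'} (ed : Edge m' n' k) → edgeAt k x ≡ nothing → ¬ HasEnd ed x
  edgeAt-nothing⇒¬hasEnd ed eq h with () ← trans (sym (edgeAt-hasEnd ed h)) eq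

  sort : Edge m' n' k → Sort
  sort (ver _ _) = vertical
  sort (hor _ _) = horizontal
  sort (wTG _)   = wrapping
  sort (wKB _)   = wrapping

  private
    verticals horizontals : List (Edge m' n' k)
    verticals   = concatMap (λ i → map (ver i) (allFin (suc n'))) (allFin (suc m'))
    horizontals = concatMap (λ i → map (hor i) (allFin n')) (allFin (suc m'))

    sort-≢ : {ed : Edge m' n' k} {s s' : Sort} → s ≢ s' → sort ed ≡ s → sort ed ≢ s'
    sort-≢ s≢s' p q = s≢s' (trans (sym p) q)

    grid-unique : {ws : List (Edge m' n' k)} → Unique ws → All (λ ed → sort ed ≡ wrapping) ws →
      Unique (verticals ++ horizontals ++ ws)
    grid-unique uws sws =
      Uniqueₚ.++⁺ uvs (Uniqueₚ.++⁺ uhs uws (disjoint-by sort shs (All.map (sort-≢ λ ()) sws)))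
        (disjoint-by sort svs (Allₚ.++⁺ (All.map (sort-≢ λ ()) shs) (All.map (sort-≢ λ ()) sws)))
      where
      uvs = unique-concatMap-map ver (λ { refl → refl , refl }) (Uniqueₚ.allFin⁺ _) (Uniqueₚ.allFin⁺ _)
      uhs = unique-concatMap-map hor (λ { refl → refl , refl }) (Uniqueₚ.allFin⁺ _) (Uniqueₚ.allFin⁺ _)
      svs = all-concatMap-map ver (allFin (suc m')) (allFin (suc n')) (λ _ _ → refl)
      shs = all-concatMap-map hor (allFin (suc m')) (allFin n') (λ _ _ → refl)

  edgeList-unique : (k : Kind m') → Unique (edgeList m' n' k)
  edgeList-unique TnC    = grid-unique [] []
  edgeList-unique (TG p) = grid-unique (Uniqueₚ.map⁺ (λ { refl → refl }) (Uniqueₚ.allFin⁺ _))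
                                       (Allₚ.map⁺ (All.universal (λ _ → refl) _))
  edgeList-unique (KB p) = grid-unique (Uniqueₚ.map⁺ (λ { refl → refl }) (Uniqueₚ.allFin⁺ _))
                                       (Allₚ.map⁺ (All.universal (λ _ → refl) _))

  edgeList-complete : (ed : Edge m' n' k) → ed ∈ edgeList m' n' k
  edgeList-complete (ver i j) = ∈-++⁺ˡ (∈-concatMap-map ver (∈-allFin i) (∈-allFin j))
  edgeList-complete (hor i j) = ∈-++⁺ʳ verticals (∈-++⁺ˡ (∈-concatMap-map hor (∈-allFin i) (∈-allFin j)))
  edgeList-complete (wTG i)   = ∈-++⁺ʳ verticals (∈-++⁺ʳ horizontals (∈-map⁺ wTG (∈-allFin i)))
  edgeList-complete (wKB i)   = ∈-++⁺ʳ verticals (∈-++⁺ʳ horizontals (∈-map⁺ wKB (∈-allFin i)))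

  sameEnd : End m' n' → End m' n' → Bool
  sameEnd (v , δ) (w , δ') = sameVertex v w ∧ isYes (δ ≟ᴰ δ')

  sameEnd-≡ : ∀ (x y : End m' n') → T (sameEnd x y) ⇔ x ≡ y
  sameEnd-≡ ((i , j) , δ) ((i' , j') , δ') =
    T-∧-pair (T-∧-pair (T-isYes (i ≟ i')) (T-isYes (j ≟ j'))) (T-isYes (δ ≟ᴰ δ'))

  sameEnd-refl : ∀ (x : End m' n') → sameEnd x x ≡ true
  sameEnd-refl x = to T-≡ (from (sameEnd-≡ x x) refl)

  sameEnd-≢ : ∀ {x y : End m' n'} → x ≢ y → sameEnd x y ≡ false
  sameEnd-≢ {x} {y} x≢y = ¬T⇒≡false (λ t → x≢y (to (sameEnd-≡ x y) t))

  endCount : End m' n' → Edge m' n' k → ℕ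
  endCount x ed = b2n (sameEnd x (proj₁ (ends ed))) + b2n (sameEnd x (proj₂ (ends ed)))

  vertex-split : ∀ (v : Vertex m' n') (y : End m' n') →
    b2n (sameVertex v (proj₁ y)) ≡ Σᴰ (λ δ → b2n (sameEnd (v , δ) y))
  vertex-split v (w , δ₀) = indicator-split (sameVertex v w) δ₀

  endsAt-split : ∀ (v : Vertex m' n') (ed : Edge m' n' k) → endsAt v ed ≡ Σᴰ (λ δ → endCount (v , δ) ed)
  endsAt-split v ed = trans (cong₂ _+_ (vertex-split v y₁) (vertex-split v y₂))
                            (Σᴰ-+ (λ δ → b2n (sameEnd (v , δ) y₁)) (λ δ → b2n (sameEnd (v , δ) y₂)))
    where
    y₁ = proj₁ (ends ed)
    y₂ = proj₂ (ends ed)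

  endCount-hasEnd : ∀ {x : End m' n'} (ed : Edge m' n' k) → HasEnd ed x → endCount x ed ≡ 1
  endCount-hasEnd ed (inj₁ refl)
    rewrite sameEnd-refl (proj₁ (ends ed)) | sameEnd-≢ (ends-distinct ed) = refl
  endCount-hasEnd ed (inj₂ refl)
    rewrite sameEnd-refl (proj₂ (ends ed)) | sameEnd-≢ (≢-sym (ends-distinct ed)) = refl

  endCount-¬hasEnd : ∀ {x : End m' n'} (ed : Edge m' n' k) → ¬ HasEnd ed x → endCount x ed ≡ 0
  endCount-¬hasEnd ed ¬h
    rewrite sameEnd-≢ (λ eq → ¬h (inj₁ (sym eq))) | sameEnd-≢ (λ eq → ¬h (inj₂ (sym eq))) = refl

  occupied : EdgeSet m' n' k → End m' n' → Bool
  occupied {k} S x = maybe′ S false (edgeAt k x)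

  incidence : EdgeSet m' n' k → End m' n' → Edge m' n' k → ℕ
  incidence S x ed = if S ed then endCount x ed else 0

  module _ {k : Kind m'} (S : EdgeSet m' n' k) where

    incidence-hasEnd : ∀ x ed → HasEnd ed x → incidence S x ed ≡ b2n (S ed)
    incidence-hasEnd x ed h with S ed
    ... | true  = endCount-hasEnd ed h
    ... | false = refl

    incidence-¬hasEnd : ∀ x ed → ¬ HasEnd ed x → incidence S x ed ≡ 0
    incidence-¬hasEnd x ed ¬h with S ed
    ... | true  = endCount-¬hasEnd ed ¬h
    ... | false = refl

    sum-incidence : ∀ x → sum (map (incidence S x) (edgeList m' n' k)) ≡ b2n (occupied S x)
    sum-incidence x with edgeAt k x in eq
    ... | just ed₀ = trans (sum-map-single (incidence S x) (edgeList-unique k) (edgeList-complete ed₀) away)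
                           (incidence-hasEnd x ed₀ (edgeAt-sound x eq))
      where
      away : ∀ ed → ed ≢ ed₀ → incidence S x ed ≡ 0
      away ed ed≢ed₀ = incidence-¬hasEnd x ed (λ h → ed≢ed₀ (hasEnd-unique ed eq h))
    ... | nothing  = sum-map-zero (incidence S x) {edgeList m' n' k}
      (All.universal (λ ed → incidence-¬hasEnd x ed (edgeAt-nothing⇒¬hasEnd ed eq)) _)

    degree-occupied : ∀ v → degree S v ≡ Σᴰ (λ δ → b2n (occupied S (v , δ)))
    degree-occupied v = begin
      degree S v
        ≡⟨ cong sum (map-cong split (edgeList m' n' k)) ⟩
      sum (map (λ ed → Σᴰ (λ δ → incidence S (v , δ) ed)) (edgeList m' n' k))
        ≡⟨ sum-map-Σᴰ (λ δ → incidence S (v , δ)) (edgeList m' n' k) ⟩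
      Σᴰ (λ δ → sum (map (incidence S (v , δ)) (edgeList m' n' k)))
        ≡⟨ Σᴰ-cong (λ δ → sum-incidence (v , δ)) ⟩
      Σᴰ (λ δ → b2n (occupied S (v , δ)))
        ∎
      where
      open ≡-Reasoning
      split : ∀ ed → (if S ed then endsAt v ed else 0) ≡ Σᴰ (λ δ → incidence S (v , δ) ed)
      split ed with S ed
      ... | true  = endsAt-split v ed
      ... | false = refl

  selects : Matrix m' n' → End m' n' → Bool
  selects M ((i , j) , δ) = dirs (M i j) δ

  occupied-⇔ : (S : EdgeSet m' n' k) (x : End m' n') →
    T (occupied S x) ⇔ (∃[ ed ] (S ed ≡ true × HasEnd ed x))
  occupied-⇔ {k} S x with edgeAt k x in eq
  ... | just ed₀ = mk⇔ (λ t → ed₀ , to T-≡ t , edgeAt-sound x eq)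
                       (λ (ed , Sed , h) → from T-≡ (subst (λ ed' → S ed' ≡ true) (hasEnd-unique ed eq h) Sed))
  ... | nothing  = mk⇔ (λ ()) (λ (ed , _ , h) → edgeAt-nothing⇒¬hasEnd ed eq h)

  occupied-end₁ : (S : EdgeSet m' n' k) (ed : Edge m' n' k) → occupied S (proj₁ (ends ed)) ≡ S ed
  occupied-end₁ S ed = cong (maybe′ S false) (edgeAt-end₁ ed)

  occupied-end₂ : (S : EdgeSet m' n' k) (ed : Edge m' n' k) → occupied S (proj₂ (ends ed)) ≡ S ed
  occupied-end₂ S ed = cong (maybe′ S false) (edgeAt-end₂ ed)

  isCodeMatrix⇔ : (S : EdgeSet m' n' k) (M : Matrix m' n') →
    IsCodeMatrix S M ⇔ (∀ x → selects M x ≡ occupied S x)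
  isCodeMatrix⇔ S M = mk⇔
    (λ code ((i , j) , δ) → T-⇔⇒≡ (⇔-trans (code i j δ) (⇔-sym (occupied-⇔ S ((i , j) , δ)))))
    (λ sel i j δ → subst (λ s → T s ⇔ _) (sym (sel ((i , j) , δ))) (occupied-⇔ S ((i , j) , δ)))

  EdgeConsistent : Kind m' → Matrix m' n' → Set
  EdgeConsistent k M = ∀ (ed : Edge m' n' k) → selects M (proj₁ (ends ed)) ≡ selects M (proj₂ (ends ed))

  NoFreeEnds : Kind m' → Matrix m' n' → Set
  NoFreeEnds k M = ∀ x → edgeAt k x ≡ nothing → selects M x ≡ false

  rightWrap-free : ∀ k {M : Matrix m' n'} i → BoundaryCond k M → rightWrap k i ≡ nothing →
    dirs (M i (fromℕ n')) right ≡ false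
  rightWrap-free TnC i (_ , bdf) _ = to (InBDF⇔right∉ _) (bdf i)

  leftWrap-free : ∀ k {M : Matrix m' n'} i → BoundaryCond k M → leftWrap k i ≡ nothing →
    dirs (M i zero) left ≡ false
  leftWrap-free TnC i (abc , _) _ = to (InABC⇔left∉ _) (abc i)

  module _ {k : Kind m'} {M : Matrix m' n'} where

    conditions⇒consistent : Conditions k M → EdgeConsistent k M
    conditions⇒consistent (cc , ac , bc) (ver i j) = T-⇔⇒≡ (cc i j)
    conditions⇒consistent (cc , ac , bc) (hor i j) = T-⇔⇒≡ (ac i j)
    conditions⇒consistent (cc , ac , bc) (wTG i)   = T-⇔⇒≡ (bc i)
    conditions⇒consistent (cc , ac , bc) (wKB i)   = trans (T-⇔⇒≡ (bc i)) (bar-left (M i zero))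

    conditions⇒noFreeEnds : Conditions k M → NoFreeEnds k M
    conditions⇒noFreeEnds (_ , _ , bc) ((i , j) , right) eq with view j
    ... | ‵fromℕ = rightWrap-free k i bc eq
    conditions⇒noFreeEnds (_ , _ , bc) ((i , zero) , left) eq = leftWrap-free k i bc eq

    consistent⇒conditions : EdgeConsistent k M → NoFreeEnds k M → Conditions k M
    consistent⇒conditions cons free =
      (λ i j → ≡⇒T-⇔ (cons (ver i j))) , (λ i j → ≡⇒T-⇔ (cons (hor i j))) , boundary k cons free
      where
      boundary : ∀ k → EdgeConsistent k M → NoFreeEnds k M → BoundaryCond k M
      boundary TnC    _    free   = (λ i → from (InABC⇔left∉ _) (free ((i , zero) , left) refl))
        , (λ i → from (InBDF⇔right∉ _) (free ((i , fromℕ n') , right) (edgeAt-rightmost TnC i)))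
      boundary (TG p) cons _    i = ≡⇒T-⇔ (cons (wTG i))
      boundary (KB p) cons _    i = ≡⇒T-⇔ (trans (cons (wKB i)) (sym (bar-left (M i zero))))

  module _ (S : EdgeSet m' n' k) where

    codeMatrix-exists : TwoFactor S → ∃[ M ] IsCodeMatrix S M
    codeMatrix-exists twoFactor = M , from (isCodeMatrix⇔ S M) (λ ((i , j) , δ) → proj₂ (letterAt (i , j)) δ)
      where
      letterAt : ∀ v → ∃[ α ] (∀ δ → dirs α δ ≡ occupied S (v , δ))
      letterAt v = letter-with-dirs (λ δ → occupied S (v , δ)) (trans (sym (degree-occupied S v)) (twoFactor v))
      M : Matrix m' n'
      M i j = proj₁ (letterAt (i , j))

    codeMatrix-conditions : ∀ M → IsCodeMatrix S M → Conditions k M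
    codeMatrix-conditions M code = consistent⇒conditions consistent free
      where
      sel = to (isCodeMatrix⇔ S M) code
      consistent : EdgeConsistent k M
      consistent ed = trans (trans (sel _) (occupied-end₁ S ed)) (sym (trans (sel _) (occupied-end₂ S ed)))
      free : NoFreeEnds k M
      free x eq = trans (sel x) (cong (maybe′ S false) eq)

  edgeSetOf : Matrix m' n' → EdgeSet m' n' k
  edgeSetOf M ed = selects M (proj₁ (ends ed))

  codeMatrix-determines : (S : EdgeSet m' n' k) (M : Matrix m' n') → IsCodeMatrix S M →
    ∀ ed → S ed ≡ edgeSetOf M ed
  codeMatrix-determines S M code ed = sym (trans (to (isCodeMatrix⇔ S M) code _) (occupied-end₁ S ed))

  module _ {k : Kind m'} (M : Matrix m' n') (cond : Conditions k M) where

    selects-occupied : ∀ x → selects M x ≡ occupied (edgeSetOf {k} M) x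
    selects-occupied x with edgeAt k x in eq
    ... | just ed = onEnd (edgeAt-sound x eq)
      where
      onEnd : HasEnd ed x → selects M x ≡ edgeSetOf M ed
      onEnd (inj₁ refl) = refl
      onEnd (inj₂ refl) = sym (conditions⇒consistent cond ed)
    ... | nothing = conditions⇒noFreeEnds cond x eq

    edgeSetOf-codeMatrix : IsCodeMatrix (edgeSetOf M) M
    edgeSetOf-codeMatrix = from (isCodeMatrix⇔ _ M) selects-occupied

    edgeSetOf-twoFactor : TwoFactor (edgeSetOf {k} M)
    edgeSetOf-twoFactor (i , j) = begin
      degree (edgeSetOf {k} M) (i , j)
        ≡⟨ degree-occupied _ (i , j) ⟩
      Σᴰ (λ δ → b2n (occupied (edgeSetOf {k} M) ((i , j) , δ)))
        ≡⟨ Σᴰ-cong (λ δ → cong b2n (selects-occupied ((i , j) , δ))) ⟨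
      Σᴰ (λ δ → b2n (dirs (M i j) δ))
        ≡⟨ dirs-Σᴰ (M i j) ⟩
      2 ∎
      where open ≡-Reasoning

lemma1 : (m' n' : ℕ) (k : Kind m') →
    ((S : EdgeSet m' n' k) → TwoFactor S →
      (∃[ M ] IsCodeMatrix S M)
      × ((M : Matrix m' n') → IsCodeMatrix S M → Conditions k M))
    × ((M : Matrix m' n') → Conditions k M →
      Σ (EdgeSet m' n' k) (λ S → TwoFactor S × IsCodeMatrix S M
        × ((S' : EdgeSet m' n' k) → TwoFactor S' → IsCodeMatrix S' M →
             ∀ ed → S' ed ≡ S ed)))
lemma1 m' n' k =
    (λ S twoFactor → codeMatrix-exists S twoFactor , codeMatrix-conditions S)
  , (λ M cond → edgeSetOf M , edgeSetOf-twoFactor M cond , edgeSetOf-codeMatrix M cond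
              , λ S' _ code' → codeMatrix-determines S' M code')
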